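{- Let $F$ be an $m\times n$ binary matrix. Suppose that, after permuting rows and columns, $F=[\,A\ \ B\,]$ where $B=O$ is the $m\times b$ all-zero matrix ($1\le b\le n-1$) and $A$ is $m\times(n-b)$. Then: (a) if $w(F)=m+b$, then $v(F)=v(A)=\min(m,n-b)$; (b) if $w(A)>\max(m,n-b)$, then $w(F)>m+b$; (c) if $w(F)=m+b$, then $w(A)\le\max(m,n-b)$.
   Context: A binary matrix is a matrix with entries $0$ or $1$. A set of ones of a binary matrix is independent if no two lie in the same row or column; $v(F)$ is the maximum number of independent ones in $F$. A zero submatrix of $F$ of order $a\times b$ ($a,b\ge1$) is given by a choice of $a$ rows and $b$ columns all of whose common entries are $0$; $w(F)$ is the maximum of $a+b$ over all zero submatrices of $F$, and $w(F)=0$ if $F$ has no zero entry. $v$ and $w$ are invariant under permutations of rows and columns. -}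

module Defs where

open import Data.Bool using (Bool; true; false)
open import Data.Nat using (ℕ; _+_; _≤_; _>_; suc)
open import Data.Fin using (Fin; splitAt)
open import Data.Fin.Subset using (Subset; _∈_; ∣_∣)
open import Data.Sum using (_⊎_; [_,_])
open import Data.Product using (Σ; ∃; _×_; _,_)
open import Function using (const)
open import Function.Definitions using (Injective)
open import Relation.Binary.PropositionalEquality using (_≡_)

-- An m × n binary matrix; entry true = 1, false = 0.
BinMatrix : ℕ → ℕ → Set
BinMatrix m n = Fin m → Fin n → Bool

IsMaximum : (ℕ → Set) → ℕ → Set
IsMaximum P k = P k × (∀ j → P j → j ≤ k)

HasIndepOnes : ∀ {m n} → BinMatrix m n → ℕ → Set
HasIndepOnes {m} {n} F k =
  Σ (Fin k → Fin m) λ r → Σ (Fin k → Fin n) λ c →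
    Injective _≡_ _≡_ r × Injective _≡_ _≡_ c × (∀ i → F (r i) (c i) ≡ true)

IsV : ∀ {m n} → BinMatrix m n → ℕ → Set
IsV F k = IsMaximum (HasIndepOnes F) k

HasZeroSubmatrixSum : ∀ {m n} → BinMatrix m n → ℕ → Set
HasZeroSubmatrixSum {m} {n} F s =
  Σ (Subset m) λ R → Σ (Subset n) λ C →
    1 ≤ ∣ R ∣ × 1 ≤ ∣ C ∣ × ∣ R ∣ + ∣ C ∣ ≡ s ×
    (∀ i j → i ∈ R → j ∈ C → F i j ≡ false)

-- candidate values for w: a + b over zero submatrices, and 0
-- (so that w(F) = 0 exactly when F has no zero entry)
WCandidate : ∀ {m n} → BinMatrix m n → ℕ → Set
WCandidate F s = (s ≡ 0) ⊎ HasZeroSubmatrixSum F s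

IsW : ∀ {m n} → BinMatrix m n → ℕ → Set
IsW F k = IsMaximum (WCandidate F) k

AppendZero : ∀ {m k} (b : ℕ) → BinMatrix m k → BinMatrix m (k + b)
AppendZero {k = k} b A i j = [ A i , const false ] (splitAt k j)

module Submission where

-- (b) and (c) rest on one observation: a zero submatrix R × C of A extends to the zero
-- submatrix R × (C plus the b zero columns) of F, so every zero submatrix of A of order
-- sum s yields w(F) ≥ s + b (`zero-appendZero`, `zero-permute`).
-- (a) If w(F) = m + b, every zero submatrix of A therefore has order sum at most m.  By the
-- Frobenius–König theorem (one direction) A then has min(m, k) independent ones; they lift
-- to F, and no matrix whose ones lie in m rows and k columns has more.
--
-- Frobenius–König is derived from Hall's theorem for a family of subsets G r ⊆ Fin n
-- (a system of distinct representatives or a set S of indices with fewer than ∣ S ∣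
-- neighbours), proved by Rado's argument: induction on the total size of the family,
-- deleting one of two elements of a set G x and merging the two resulting violators.
-- A violator of Hall's condition spans a zero submatrix that is too large.

open import Defs
open import Data.Bool.Base using (Bool; true; false)
open import Data.Bool.Properties using (¬-not)
open import Data.Fin.Base using (Fin; zero; suc; splitAt; _↑ˡ_)
open import Data.Fin.Properties
  using (any?; all?; ¬∀⟶∃¬; injective⇒≤; ↑ˡ-injective; splitAt-↑ˡ; splitAt⁻¹-↑ˡ)
  renaming (_≟_ to _≟ᶠ_)
open import Data.Fin.Permutation using (Permutation′; _⟨$⟩ʳ_; _⟨$⟩ˡ_; flip; inverseʳ)
open import Data.Fin.Subset
  using (Subset; inside; outside; _∈_; _∉_; _⊆_; ∣_∣; _∪_; _∩_; _-_; ∁; ⁅_⁆; ⊤; Empty)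
open import Data.Fin.Subset.Properties
  using ( _∈?_; nonempty?; Empty-unique; ∣⊥∣≡0; ∣⊤∣≡n; ∣⁅x⁆∣≡1; ∣p∣≤n; ∣∁p∣≡n∸∣p∣
        ; p⊆q⇒∣p∣≤∣q∣; x∈p⇒∣p-x∣<∣p∣; x∈⁅x⁆; x∈⁅y⁆⇒x≡y; x∈∁p⇒x∉p
        ; x∈p∪q⁺; x∈p∪q⁻; x∈p∩q⁺; x∈p∩q⁻; p─q⊆p; x∈p∧x≢y⇒x∈p-y )
open import Data.Nat.Base using (ℕ; zero; suc; _+_; _∸_; _≤_; _<_; _⊔_; _⊓_; z≤n; s≤s; s≤s⁻¹)
open import Data.Nat.Properties
open import Data.Nat.Induction using (<-wellFounded)
open import Data.Product.Base using (∃; Σ; _×_; _,_; proj₁; proj₂)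
open import Data.Sum.Base using (_⊎_; inj₁; inj₂; [_,_]′; map)
open import Data.Vec.Base using ([]; _∷_; there; lookup; tabulate; _++_)
open import Data.Vec.Properties using (lookup∘tabulate; tabulate∘lookup; []=⇒lookup; lookup⇒[]=; lookup-++ˡ)
open import Data.Vec.Functional using (updateAt)
open import Data.Vec.Functional.Properties using (updateAt-updates; updateAt-minimal)
open import Function.Base using (_∘_; id; const)
open import Function.Bundles using (Injection)
open import Function.Definitions using (Injective)
open import Function.Properties.Inverse using (↔⇒↣)
open import Induction.WellFounded using (Acc; acc)
open import Relation.Nullary using (Dec; yes; no; does; contradiction)
open import Relation.Nullary.Decidable using (dec-true; _×-dec_; ¬?)
open import Relation.Binary.PropositionalEquality
open import Algebra.Properties.CommutativeMonoid.Sum +-0-commutativeMonoid using (sum; sum-permute)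

private
  variable
    m n k t : ℕ

∣p∪q∣+∣p∩q∣≡∣p∣+∣q∣ : (p q : Subset n) → ∣ p ∪ q ∣ + ∣ p ∩ q ∣ ≡ ∣ p ∣ + ∣ q ∣
∣p∪q∣+∣p∩q∣≡∣p∣+∣q∣ []            []            = refl
∣p∪q∣+∣p∩q∣≡∣p∣+∣q∣ (outside ∷ p) (outside ∷ q) = ∣p∪q∣+∣p∩q∣≡∣p∣+∣q∣ p q
∣p∪q∣+∣p∩q∣≡∣p∣+∣q∣ (inside ∷ p)  (outside ∷ q) = cong suc (∣p∪q∣+∣p∩q∣≡∣p∣+∣q∣ p q)
∣p∪q∣+∣p∩q∣≡∣p∣+∣q∣ (outside ∷ p) (inside ∷ q)  =
  trans (cong suc (∣p∪q∣+∣p∩q∣≡∣p∣+∣q∣ p q)) (sym (+-suc ∣ p ∣ ∣ q ∣))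
∣p∪q∣+∣p∩q∣≡∣p∣+∣q∣ (inside ∷ p)  (inside ∷ q)  = cong suc (begin
  ∣ p ∪ q ∣ + suc ∣ p ∩ q ∣   ≡⟨ +-suc ∣ p ∪ q ∣ ∣ p ∩ q ∣ ⟩
  suc (∣ p ∪ q ∣ + ∣ p ∩ q ∣) ≡⟨ cong suc (∣p∪q∣+∣p∩q∣≡∣p∣+∣q∣ p q) ⟩
  suc (∣ p ∣ + ∣ q ∣)         ≡⟨ +-suc ∣ p ∣ ∣ q ∣ ⟨
  ∣ p ∣ + suc ∣ q ∣           ∎)
  where open ≡-Reasoning

∣p∪q∣≤∣p∣+∣q∣ : (p q : Subset n) → ∣ p ∪ q ∣ ≤ ∣ p ∣ + ∣ q ∣
∣p∪q∣≤∣p∣+∣q∣ p q =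
  ≤-trans (m≤m+n ∣ p ∪ q ∣ ∣ p ∩ q ∣) (≤-reflexive (∣p∪q∣+∣p∩q∣≡∣p∣+∣q∣ p q))

Empty⇒∣p∣≡0 : {p : Subset n} → Empty p → ∣ p ∣ ≡ 0
Empty⇒∣p∣≡0 {n} empty = trans (cong ∣_∣ (Empty-unique empty)) (∣⊥∣≡0 n)

∣p∣≤∣p-x∣+1 : (p : Subset n) (x : Fin n) → ∣ p ∣ ≤ ∣ p - x ∣ + 1
∣p∣≤∣p-x∣+1 p x = begin
  ∣ p ∣                   ≤⟨ p⊆q⇒∣p∣≤∣q∣ p⊆[p-x]∪⁅x⁆ ⟩
  ∣ (p - x) ∪ ⁅ x ⁆ ∣     ≤⟨ ∣p∪q∣≤∣p∣+∣q∣ (p - x) ⁅ x ⁆ ⟩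
  ∣ p - x ∣ + ∣ ⁅ x ⁆ ∣   ≡⟨ cong (∣ p - x ∣ +_) (∣⁅x⁆∣≡1 x) ⟩
  ∣ p - x ∣ + 1           ∎
  where
  open ≤-Reasoning
  p⊆[p-x]∪⁅x⁆ : p ⊆ (p - x) ∪ ⁅ x ⁆
  p⊆[p-x]∪⁅x⁆ {y} y∈p with y ≟ᶠ x
  ... | yes refl = x∈p∪q⁺ (inj₂ (x∈⁅x⁆ x))
  ... | no y≢x   = x∈p∪q⁺ (inj₁ (x∈p∧x≢y⇒x∈p-y y∈p y≢x))

x∉p-x : (p : Subset n) (x : Fin n) → x ∉ p - x
x∉p-x (inside ∷ p)  zero    ()
x∉p-x (outside ∷ p) zero    ()
x∉p-x (_ ∷ p)       (suc x) (there x∈p-x) = x∉p-x p x x∈p-x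

∣p++q∣≡∣p∣+∣q∣ : (p : Subset m) (q : Subset n) → ∣ p ++ q ∣ ≡ ∣ p ∣ + ∣ q ∣
∣p++q∣≡∣p∣+∣q∣ []            q = refl
∣p++q∣≡∣p∣+∣q∣ (inside ∷ p)  q = cong suc (∣p++q∣≡∣p∣+∣q∣ p q)
∣p++q∣≡∣p∣+∣q∣ (outside ∷ p) q = ∣p++q∣≡∣p∣+∣q∣ p q

∈-++⁻ˡ : (p : Subset m) (q : Subset n) {x : Fin m} → x ↑ˡ n ∈ p ++ q → x ∈ p
∈-++⁻ˡ p q {x} x∈p++q =
  lookup⇒[]= x p (trans (sym (lookup-++ˡ p q x)) ([]=⇒lookup x∈p++q))

∈-tabulate⁺ : {f : Fin n → Bool} {i : Fin n} → f i ≡ true → i ∈ tabulate f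
∈-tabulate⁺ {f = f} {i} fi≡true = lookup⇒[]= i (tabulate f) (trans (lookup∘tabulate f i) fi≡true)

∈-tabulate⁻ : {f : Fin n → Bool} {i : Fin n} → i ∈ tabulate f → f i ≡ true
∈-tabulate⁻ {f = f} {i} i∈ = trans (sym (lookup∘tabulate f i)) ([]=⇒lookup i∈)

𝟙 : Bool → ℕ
𝟙 true  = 1
𝟙 false = 0

∣tabulate∣≡∑ : (f : Fin n → Bool) → ∣ tabulate f ∣ ≡ sum (𝟙 ∘ f)
∣tabulate∣≡∑ {zero}  f = refl
∣tabulate∣≡∑ {suc n} f with f zero
... | true  = cong suc (∣tabulate∣≡∑ (f ∘ suc))
... | false = ∣tabulate∣≡∑ (f ∘ suc)

relabel : Permutation′ n → Subset n → Subset n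
relabel π p = tabulate (λ i → lookup p (π ⟨$⟩ˡ i))

∈-relabel⁻ : (π : Permutation′ n) (p : Subset n) {i : Fin n} → i ∈ relabel π p → π ⟨$⟩ˡ i ∈ p
∈-relabel⁻ π p {i} i∈ = lookup⇒[]= (π ⟨$⟩ˡ i) p (∈-tabulate⁻ i∈)

∣relabel∣ : (π : Permutation′ n) (p : Subset n) → ∣ relabel π p ∣ ≡ ∣ p ∣
∣relabel∣ π p = begin
  ∣ relabel π p ∣                 ≡⟨ ∣tabulate∣≡∑ (lookup p ∘ (π ⟨$⟩ˡ_)) ⟩
  sum (𝟙 ∘ lookup p ∘ (π ⟨$⟩ˡ_)) ≡⟨ sum-permute (𝟙 ∘ lookup p) (flip π) ⟨
  sum (𝟙 ∘ lookup p)              ≡⟨ ∣tabulate∣≡∑ (lookup p) ⟨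
  ∣ tabulate (lookup p) ∣         ≡⟨ cong ∣_∣ (tabulate∘lookup p) ⟩
  ∣ p ∣                           ∎
  where open ≡-Reasoning

sum-mono-≤ : {f g : Fin n → ℕ} → (∀ i → f i ≤ g i) → sum f ≤ sum g
sum-mono-≤ {zero}  f≤g = z≤n
sum-mono-≤ {suc n} f≤g = +-mono-≤ (f≤g zero) (sum-mono-≤ (f≤g ∘ suc))

sum-mono-< : {f g : Fin n → ℕ} → (∀ i → f i ≤ g i) → (x : Fin n) → f x < g x → sum f < sum g
sum-mono-< f≤g zero    fx<gx = +-mono-<-≤ fx<gx (sum-mono-≤ (f≤g ∘ suc))
sum-mono-< f≤g (suc x) fx<gx = +-mono-≤-< (f≤g zero) (sum-mono-< (f≤g ∘ suc) x fx<gx)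

+-<-split : ∀ {a b c d} → a + b < c + d → a < c ⊎ b < d
+-<-split {a} {b} {c} {d} a+b<c+d with a <? c
... | yes a<c = inj₁ a<c
... | no  a≮c = inj₂ (+-cancelˡ-< c b d (≤-<-trans (+-monoˡ-≤ b (≮⇒≥ a≮c)) a+b<c+d))

witness : ∀ {a} {A : Set a} (a? : Dec A) → does a? ≡ true → A
witness (yes a) _  = a
witness (no _)  ()

Family : ℕ → ℕ → Set
Family m n = Fin m → Subset n

neighbours : Family m n → Subset m → Subset n
neighbours G S = tabulate (λ c → does (any? (λ r → r ∈? S ×-dec c ∈? G r)))

∈-neighbours⁺ : (G : Family m n) {S : Subset m} {r : Fin m} {c : Fin n} →
                r ∈ S → c ∈ G r → c ∈ neighbours G S
∈-neighbours⁺ G {r = r} r∈S c∈Gr = ∈-tabulate⁺ (dec-true (any? _) (r , r∈S , c∈Gr))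

∈-neighbours⁻ : (G : Family m n) {S : Subset m} {c : Fin n} →
                c ∈ neighbours G S → ∃ λ r → r ∈ S × c ∈ G r
∈-neighbours⁻ G {S} {c} c∈ = witness (any? (λ r → r ∈? S ×-dec c ∈? G r)) (∈-tabulate⁻ c∈)

SDR : Family m n → Set
SDR {m} {n} G = Σ (Fin m → Fin n) λ c → Injective _≡_ _≡_ c × (∀ i → c i ∈ G i)

Violator : Family m n → Set
Violator {m} G = Σ (Subset m) λ S → ∣ neighbours G S ∣ < ∣ S ∣

delete : Family m n → Fin m → Fin n → Family m n
delete G x y = updateAt G x (_- y)

module _ (G : Family m n) (x : Fin m) (y : Fin n) where

  ∈-delete⁻ : ∀ {r c} → c ∈ delete G x y r → c ∈ G r
  ∈-delete⁻ {r} {c} c∈ with r ≟ᶠ x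
  ... | yes refl = p─q⊆p (G x) ⁅ y ⁆ (subst (c ∈_) (updateAt-updates x G) c∈)
  ... | no r≢x   = subst (c ∈_) (updateAt-minimal r x G r≢x) c∈

  ∈-delete⁺ : ∀ {r c} → c ∈ G r → r ≢ x ⊎ c ≢ y → c ∈ delete G x y r
  ∈-delete⁺ {r} {c} c∈ r≢x⊎c≢y with r ≟ᶠ x | r≢x⊎c≢y
  ... | no r≢x   | _         = subst (c ∈_) (sym (updateAt-minimal r x G r≢x)) c∈
  ... | yes refl | inj₁ x≢x  = contradiction refl x≢x
  ... | yes refl | inj₂ c≢y  = subst (c ∈_) (sym (updateAt-updates x G)) (x∈p∧x≢y⇒x∈p-y c∈ c≢y)

  sdr-delete : SDR (delete G x y) → SDR G
  sdr-delete (c , c-inj , c∈) = c , c-inj , ∈-delete⁻ ∘ c∈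

  violator-delete : {S : Subset m} → x ∉ S → ∣ neighbours (delete G x y) S ∣ < ∣ S ∣ → Violator G
  violator-delete {S} x∉S violates = S , ≤-<-trans (p⊆q⇒∣p∣≤∣q∣ N⊆N′) violates
    where
    N⊆N′ : neighbours G S ⊆ neighbours (delete G x y) S
    N⊆N′ c∈ with ∈-neighbours⁻ G c∈
    ... | r , r∈S , c∈Gr = ∈-neighbours⁺ (delete G x y) r∈S (∈-delete⁺ c∈Gr (inj₁ λ { refl → x∉S r∈S }))

size : Family m n → ℕ
size G = sum (λ i → ∣ G i ∣)

size-delete : (G : Family m n) (x : Fin m) {y : Fin n} → y ∈ G x → size (delete G x y) < size G
size-delete G x {y} y∈Gx = sum-mono-< (λ r → p⊆q⇒∣p∣≤∣q∣ (∈-delete⁻ G x y)) x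
  (subst (λ p → ∣ p ∣ < ∣ G x ∣) (sym (updateAt-updates x G)) (x∈p⇒∣p-x∣<∣p∣ y∈Gx))

-- Let y₁ ≢ y₂ and let S₁, S₂ ∋ x violate Hall's condition for G with
-- y₁ resp. y₂ removed from G x.  Then S₁ ∪ S₂ or (S₁ ∩ S₂) - x violates it for G, because
-- their neighbourhoods lie in N₁ ∪ N₂ and N₁ ∩ N₂, and the modular law counts both sides.
merge-violators : (G : Family m n) {x : Fin m} {y₁ y₂ : Fin n} {S₁ S₂ : Subset m} →
  y₁ ≢ y₂ → x ∈ S₁ → x ∈ S₂ →
  ∣ neighbours (delete G x y₁) S₁ ∣ < ∣ S₁ ∣ → ∣ neighbours (delete G x y₂) S₂ ∣ < ∣ S₂ ∣ →
  Violator G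
merge-violators {m = m} {n = n} G {x} {y₁} {y₂} {S₁} {S₂} y₁≢y₂ x∈S₁ x∈S₂ violates₁ violates₂ =
  [ (λ U-violates → U , U-violates) , (λ I-violates → I , I-violates) ]′ (+-<-split counting)
  where
  U I : Subset m
  U = S₁ ∪ S₂
  I = (S₁ ∩ S₂) - x
  G₁ G₂ : Family m n
  G₁ = delete G x y₁
  G₂ = delete G x y₂
  N₁ N₂ : Subset n
  N₁ = neighbours G₁ S₁
  N₂ = neighbours G₂ S₂

  survives : ∀ {r c} → c ∈ G r → c ∈ G₁ r ⊎ c ∈ G₂ r
  survives {c = c} c∈Gr with c ≟ᶠ y₁
  ... | no c≢y₁  = inj₁ (∈-delete⁺ G x y₁ c∈Gr (inj₂ c≢y₁))
  ... | yes refl = inj₂ (∈-delete⁺ G x y₂ c∈Gr (inj₂ y₁≢y₂))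

  NU⊆N₁∪N₂ : neighbours G U ⊆ N₁ ∪ N₂
  NU⊆N₁∪N₂ c∈ with ∈-neighbours⁻ G c∈
  ... | r , r∈U , c∈Gr with r ≟ᶠ x
  ...   | yes refl = x∈p∪q⁺ (map (∈-neighbours⁺ G₁ x∈S₁) (∈-neighbours⁺ G₂ x∈S₂) (survives c∈Gr))
  ...   | no r≢x   = x∈p∪q⁺ (map (λ r∈S₁ → ∈-neighbours⁺ G₁ r∈S₁ (∈-delete⁺ G x y₁ c∈Gr (inj₁ r≢x)))
                                   (λ r∈S₂ → ∈-neighbours⁺ G₂ r∈S₂ (∈-delete⁺ G x y₂ c∈Gr (inj₁ r≢x)))
                                   (x∈p∪q⁻ S₁ S₂ r∈U))

  NI⊆N₁∩N₂ : neighbours G I ⊆ N₁ ∩ N₂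
  NI⊆N₁∩N₂ c∈ with ∈-neighbours⁻ G c∈
  ... | r , r∈I , c∈Gr with x∈p∩q⁻ S₁ S₂ (p─q⊆p (S₁ ∩ S₂) ⁅ x ⁆ r∈I)
  ...   | r∈S₁ , r∈S₂ = x∈p∩q⁺ ( ∈-neighbours⁺ G₁ r∈S₁ (∈-delete⁺ G x y₁ c∈Gr (inj₁ r≢x))
                               , ∈-neighbours⁺ G₂ r∈S₂ (∈-delete⁺ G x y₂ c∈Gr (inj₁ r≢x)))
    where
    r≢x : r ≢ x
    r≢x refl = x∉p-x (S₁ ∩ S₂) x r∈I

  counting : ∣ neighbours G U ∣ + ∣ neighbours G I ∣ < ∣ U ∣ + ∣ I ∣
  counting = s≤s⁻¹ (begin
    suc (suc (∣ neighbours G U ∣ + ∣ neighbours G I ∣))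
      ≤⟨ s≤s (s≤s (+-mono-≤ (p⊆q⇒∣p∣≤∣q∣ NU⊆N₁∪N₂) (p⊆q⇒∣p∣≤∣q∣ NI⊆N₁∩N₂))) ⟩
    suc (suc (∣ N₁ ∪ N₂ ∣ + ∣ N₁ ∩ N₂ ∣))  ≡⟨ cong (λ a → suc (suc a)) (∣p∪q∣+∣p∩q∣≡∣p∣+∣q∣ N₁ N₂) ⟩
    suc (suc (∣ N₁ ∣ + ∣ N₂ ∣))            ≡⟨ cong suc (+-suc ∣ N₁ ∣ ∣ N₂ ∣) ⟨
    suc ∣ N₁ ∣ + suc ∣ N₂ ∣                ≤⟨ +-mono-≤ violates₁ violates₂ ⟩
    ∣ S₁ ∣ + ∣ S₂ ∣                        ≡⟨ ∣p∪q∣+∣p∩q∣≡∣p∣+∣q∣ S₁ S₂ ⟨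
    ∣ U ∣ + ∣ S₁ ∩ S₂ ∣                    ≤⟨ +-monoʳ-≤ ∣ U ∣ (∣p∣≤∣p-x∣+1 (S₁ ∩ S₂) x) ⟩
    ∣ U ∣ + (∣ I ∣ + 1)                    ≡⟨ cong (∣ U ∣ +_) (+-comm ∣ I ∣ 1) ⟩
    ∣ U ∣ + suc ∣ I ∣                      ≡⟨ +-suc ∣ U ∣ ∣ I ∣ ⟩
    suc (∣ U ∣ + ∣ I ∣)                    ∎)
    where open ≤-Reasoning

rado-step : (G : Family m n) {x : Fin m} {y₁ y₂ : Fin n} → y₁ ≢ y₂ →
  SDR (delete G x y₁) ⊎ Violator (delete G x y₁) →
  SDR (delete G x y₂) ⊎ Violator (delete G x y₂) → SDR G ⊎ Violator G
rado-step G {x} {y₁} _ (inj₁ sdr₁) _ = inj₁ (sdr-delete G x y₁ sdr₁)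
rado-step G {x} {y₂ = y₂} _ (inj₂ _) (inj₁ sdr₂) = inj₁ (sdr-delete G x y₂ sdr₂)
rado-step G {x} {y₁} {y₂} y₁≢y₂ (inj₂ (S₁ , violates₁)) (inj₂ (S₂ , violates₂))
  with x ∈? S₁ | x ∈? S₂
... | no x∉S₁  | _         = inj₂ (violator-delete G x y₁ x∉S₁ violates₁)
... | yes _    | no x∉S₂   = inj₂ (violator-delete G x y₂ x∉S₂ violates₂)
... | yes x∈S₁ | yes x∈S₂  = inj₂ (merge-violators G y₁≢y₂ x∈S₁ x∈S₂ violates₁ violates₂)

empty-violator : (G : Family m n) {x : Fin m} → Empty (G x) → Violator G
empty-violator G {x} Gx-empty =
  ⁅ x ⁆ , subst₂ _<_ (sym (Empty⇒∣p∣≡0 no-neighbour)) (sym (∣⁅x⁆∣≡1 x)) (s≤s z≤n)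
  where
  no-neighbour : Empty (neighbours G ⁅ x ⁆)
  no-neighbour (c , c∈) with ∈-neighbours⁻ G c∈
  ... | r , r∈⁅x⁆ , c∈Gr with x∈⁅y⁆⇒x≡y x r∈⁅x⁆
  ...   | refl = Gx-empty (c , c∈Gr)

collision-violator : (G : Family m n) (c : Fin m → Fin n) → (∀ r {y} → y ∈ G r → y ≡ c r) →
                     {i j : Fin m} → i ≢ j → c i ≡ c j → Violator G
collision-violator {m = m} G c in-singleton {i} {j} i≢j ci≡cj = S , (begin-strict
  ∣ neighbours G S ∣ ≤⟨ p⊆q⇒∣p∣≤∣q∣ N⊆⁅ci⁆ ⟩
  ∣ ⁅ c i ⁆ ∣        ≡⟨ ∣⁅x⁆∣≡1 (c i) ⟩
  1                  <⟨ ≤-refl ⟩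
  2                  ≡⟨ ∣S∣≡2 ⟨
  ∣ S ∣              ∎)
  where
  open ≤-Reasoning
  S : Subset m
  S = ⁅ i ⁆ ∪ ⁅ j ⁆

  c-constant : ∀ {r} → r ∈ S → c r ≡ c i
  c-constant r∈S with x∈p∪q⁻ ⁅ i ⁆ ⁅ j ⁆ r∈S
  ... | inj₁ r∈⁅i⁆ = cong c (x∈⁅y⁆⇒x≡y i r∈⁅i⁆)
  ... | inj₂ r∈⁅j⁆ = trans (cong c (x∈⁅y⁆⇒x≡y j r∈⁅j⁆)) (sym ci≡cj)

  N⊆⁅ci⁆ : neighbours G S ⊆ ⁅ c i ⁆
  N⊆⁅ci⁆ y∈N with ∈-neighbours⁻ G y∈N
  ... | r , r∈S , y∈Gr =
    subst (_∈ ⁅ c i ⁆) (sym (trans (in-singleton r y∈Gr) (c-constant r∈S))) (x∈⁅x⁆ (c i))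

  disjoint : Empty (⁅ i ⁆ ∩ ⁅ j ⁆)
  disjoint (r , r∈) with x∈p∩q⁻ ⁅ i ⁆ ⁅ j ⁆ r∈
  ... | r∈⁅i⁆ , r∈⁅j⁆ = i≢j (trans (sym (x∈⁅y⁆⇒x≡y i r∈⁅i⁆)) (x∈⁅y⁆⇒x≡y j r∈⁅j⁆))

  ∣S∣≡2 : ∣ S ∣ ≡ 2
  ∣S∣≡2 = begin-equality
    ∣ S ∣                     ≡⟨ +-identityʳ ∣ S ∣ ⟨
    ∣ S ∣ + 0                 ≡⟨ cong (∣ S ∣ +_) (Empty⇒∣p∣≡0 disjoint) ⟨
    ∣ S ∣ + ∣ ⁅ i ⁆ ∩ ⁅ j ⁆ ∣ ≡⟨ ∣p∪q∣+∣p∩q∣≡∣p∣+∣q∣ ⁅ i ⁆ ⁅ j ⁆ ⟩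
    ∣ ⁅ i ⁆ ∣ + ∣ ⁅ j ⁆ ∣     ≡⟨ cong₂ _+_ (∣⁅x⁆∣≡1 i) (∣⁅x⁆∣≡1 j) ⟩
    2                         ∎

hall-singletons : (G : Family m n) (c : Fin m → Fin n) →
                  (∀ r → c r ∈ G r) → (∀ r {y} → y ∈ G r → y ≡ c r) → SDR G ⊎ Violator G
hall-singletons G c c∈G in-singleton with any? (λ i → any? (λ j → (c i ≟ᶠ c j) ×-dec ¬? (i ≟ᶠ j)))
... | yes (i , j , ci≡cj , i≢j) = inj₂ (collision-violator G c in-singleton i≢j ci≡cj)
... | no no-collision = inj₁ (c , c-injective , c∈G)
  where
  c-injective : Injective _≡_ _≡_ c
  c-injective {i} {j} ci≡cj with i ≟ᶠ j
  ... | yes i≡j = i≡j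
  ... | no i≢j  = contradiction (i , j , ci≡cj , i≢j) no-collision

hall-small : (G : Family m n) → (∀ r {y y′} → y ∈ G r → y′ ∈ G r → y ≡ y′) → SDR G ⊎ Violator G
hall-small G at-most-one with all? (λ r → nonempty? (G r))
... | no ¬all-nonempty =
  inj₂ (empty-violator G (proj₂ (¬∀⟶∃¬ _ _ (λ r → nonempty? (G r)) ¬all-nonempty)))
... | yes nonempty = hall-singletons G (proj₁ ∘ nonempty) (proj₂ ∘ nonempty)
                       (λ r y∈Gr → at-most-one r y∈Gr (proj₂ (nonempty r)))

hall-acc : (G : Family m n) → Acc _<_ (size G) → SDR G ⊎ Violator G
hall-acc G (acc smaller) with any? (λ x → any? (λ y₁ → any? (λ y₂ →
                                  ¬? (y₁ ≟ᶠ y₂) ×-dec y₁ ∈? G x ×-dec y₂ ∈? G x)))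
... | yes (x , y₁ , y₂ , y₁≢y₂ , y₁∈Gx , y₂∈Gx) =
  rado-step G y₁≢y₂ (hall-acc (delete G x y₁) (smaller (size-delete G x y₁∈Gx)))
                    (hall-acc (delete G x y₂) (smaller (size-delete G x y₂∈Gx)))
... | no no-pair = hall-small G at-most-one
  where
  at-most-one : ∀ x {y y′} → y ∈ G x → y′ ∈ G x → y ≡ y′
  at-most-one x {y} {y′} y∈Gx y′∈Gx with y ≟ᶠ y′
  ... | yes y≡y′ = y≡y′
  ... | no y≢y′  = contradiction (x , y , y′ , y≢y′ , y∈Gx , y′∈Gx) no-pair

hall : (G : Family m n) → SDR G ⊎ Violator G
hall G = hall-acc G (<-wellFounded (size G))

rows : BinMatrix m n → Family m n
rows A i = tabulate (A i)

transpose : BinMatrix m n → BinMatrix n m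
transpose A j i = A i j

-- A Hall violator S of the rows of A with ∣ S ∣ ≤ n spans the zero submatrix S × ∁ N(S),
-- whose order sum exceeds n.
violator⇒zero : (A : BinMatrix m n) (S : Subset m) → ∣ neighbours (rows A) S ∣ < ∣ S ∣ →
                ∣ S ∣ ≤ n → ∃ λ s → n < s × HasZeroSubmatrixSum A s
violator⇒zero {n = n} A S violates ∣S∣≤n =
  ∣ S ∣ + ∣ ∁ N ∣ , n<s , S , ∁ N , ≤-trans (s≤s z≤n) violates , 1≤∣∁N∣ , refl , zero-block
  where
  N : Subset n
  N = neighbours (rows A) S

  1≤∣∁N∣ : 1 ≤ ∣ ∁ N ∣
  1≤∣∁N∣ = subst (1 ≤_) (sym (∣∁p∣≡n∸∣p∣ N)) (m<n⇒0<n∸m (<-≤-trans violates ∣S∣≤n))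

  n<s : n < ∣ S ∣ + ∣ ∁ N ∣
  n<s = begin-strict
    n                   ≡⟨ m+[n∸m]≡n (∣p∣≤n N) ⟨
    ∣ N ∣ + (n ∸ ∣ N ∣) <⟨ +-monoˡ-< (n ∸ ∣ N ∣) violates ⟩
    ∣ S ∣ + (n ∸ ∣ N ∣) ≡⟨ cong (∣ S ∣ +_) (∣∁p∣≡n∸∣p∣ N) ⟨
    ∣ S ∣ + ∣ ∁ N ∣     ∎
    where open ≤-Reasoning

  zero-block : ∀ i j → i ∈ S → j ∈ ∁ N → A i j ≡ false
  zero-block i j i∈S j∈∁N =
    ¬-not (λ Aij≡true → x∈∁p⇒x∉p j∈∁N (∈-neighbours⁺ (rows A) i∈S (∈-tabulate⁺ Aij≡true)))

row-matching : (A : BinMatrix m n) → m ≤ n → (∀ s → HasZeroSubmatrixSum A s → s ≤ n) → SDR (rows A)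
row-matching A m≤n zeros-small with hall (rows A)
... | inj₁ sdr = sdr
... | inj₂ (S , violates) with violator⇒zero A S violates (≤-trans (∣p∣≤n S) m≤n)
...   | s , n<s , zero-s = contradiction (zeros-small s zero-s) (<⇒≱ n<s)

sdr⇒indep : (A : BinMatrix m n) → SDR (rows A) → HasIndepOnes A m
sdr⇒indep A (c , c-injective , c∈) = id , c , id , c-injective , ∈-tabulate⁻ ∘ c∈

indep-transpose : (A : BinMatrix m n) → HasIndepOnes (transpose A) t → HasIndepOnes A t
indep-transpose A (r , c , r-injective , c-injective , ones) = c , r , c-injective , r-injective , ones

zero-transpose : (A : BinMatrix m n) {s : ℕ} → HasZeroSubmatrixSum (transpose A) s → HasZeroSubmatrixSum A s
zero-transpose A (R , C , 1≤∣R∣ , 1≤∣C∣ , sum≡s , zero-block) =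
  C , R , 1≤∣C∣ , 1≤∣R∣ , trans (+-comm ∣ C ∣ ∣ R ∣) sum≡s , λ i j i∈C j∈R → zero-block j i j∈R i∈C

-- Frobenius–König (the direction needed): if every zero submatrix of A has order sum at most
-- max(m, n), then A has min(m, n) independent ones.  Apply Hall to A or to its transpose.
frobenius-konig : (A : BinMatrix m n) → (∀ s → HasZeroSubmatrixSum A s → s ≤ m ⊔ n) →
                  HasIndepOnes A (m ⊓ n)
frobenius-konig {m} {n} A zeros-small with m ≤? n
... | yes m≤n = subst (HasIndepOnes A) (sym (m≤n⇒m⊓n≡m m≤n))
  (sdr⇒indep A (row-matching A m≤n λ s zero-s →
     subst (s ≤_) (m≤n⇒m⊔n≡n m≤n) (zeros-small s zero-s)))
... | no m≰n = subst (HasIndepOnes A) (sym (m≥n⇒m⊓n≡n n≤m))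
  (indep-transpose A (sdr⇒indep (transpose A) (row-matching (transpose A) n≤m λ s zero-s →
     subst (s ≤_) (m≥n⇒m⊔n≡m n≤m) (zeros-small s (zero-transpose A zero-s)))))
  where
  n≤m : n ≤ m
  n≤m = <⇒≤ (≰⇒> m≰n)

indep≤ : (A : BinMatrix m n) (t : ℕ) → HasIndepOnes A t → t ≤ m ⊓ n
indep≤ A t (r , c , r-injective , c-injective , _) = ⊓-glb (injective⇒≤ r-injective) (injective⇒≤ c-injective)

indep-embed : {m′ n′ : ℕ} {G : BinMatrix m n} {F : BinMatrix m′ n′}
  (ρ : Fin m → Fin m′) (κ : Fin n → Fin n′) →
  Injective _≡_ _≡_ ρ → Injective _≡_ _≡_ κ → (∀ i j → G i j ≡ true → F (ρ i) (κ j) ≡ true) →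
  HasIndepOnes G t → HasIndepOnes F t
indep-embed ρ κ ρ-injective κ-injective ones↦ones (r , c , r-injective , c-injective , ones) =
  ρ ∘ r , κ ∘ c , r-injective ∘ ρ-injective , c-injective ∘ κ-injective ,
  λ i → ones↦ones (r i) (c i) (ones i)

Permuted : BinMatrix m n → Permutation′ m → Permutation′ n → BinMatrix m n → Set
Permuted F σ τ G = ∀ i j → F (σ ⟨$⟩ʳ i) (τ ⟨$⟩ʳ j) ≡ G i j

permuted-sym : (F G : BinMatrix m n) (σ : Permutation′ m) (τ : Permutation′ n) →
               Permuted F σ τ G → Permuted G (flip σ) (flip τ) F
permuted-sym F G σ τ F≈G i j =
  trans (sym (F≈G (σ ⟨$⟩ˡ i) (τ ⟨$⟩ˡ j))) (cong₂ F (inverseʳ σ) (inverseʳ τ))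

indep-permute : (F G : BinMatrix m n) (σ : Permutation′ m) (τ : Permutation′ n) →
                Permuted F σ τ G → HasIndepOnes G t → HasIndepOnes F t
indep-permute F G σ τ F≈G = indep-embed {G = G} {F} (σ ⟨$⟩ʳ_) (τ ⟨$⟩ʳ_)
  (Injection.injective (↔⇒↣ σ)) (Injection.injective (↔⇒↣ τ)) (λ i j → trans (F≈G i j))

zero-permute : (F G : BinMatrix m n) (σ : Permutation′ m) (τ : Permutation′ n) →
               Permuted F σ τ G → {s : ℕ} → HasZeroSubmatrixSum G s → HasZeroSubmatrixSum F s
zero-permute F G σ τ F≈G (R , C , 1≤∣R∣ , 1≤∣C∣ , sum≡s , zero-block) =
  relabel σ R , relabel τ C ,
  subst (1 ≤_) (sym (∣relabel∣ σ R)) 1≤∣R∣ , subst (1 ≤_) (sym (∣relabel∣ τ C)) 1≤∣C∣ ,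
  trans (cong₂ _+_ (∣relabel∣ σ R) (∣relabel∣ τ C)) sum≡s ,
  λ i j i∈ j∈ → trans (sym (permuted-sym F G σ τ F≈G i j))
                      (zero-block _ _ (∈-relabel⁻ σ R i∈) (∈-relabel⁻ τ C j∈))

one-in-block : (A : BinMatrix m k) (b : ℕ) (i : Fin m) (j : Fin (k + b)) →
               [ A i , const false ]′ (splitAt k j) ≡ true → ∃ λ c → c ↑ˡ b ≡ j × A i c ≡ true
one-in-block {k = k} A b i j one with splitAt k j in split≡
... | inj₁ c = c , splitAt⁻¹-↑ˡ split≡ , one
... | inj₂ _ = contradiction one λ ()

indep-appendZero⁺ : (b : ℕ) (A : BinMatrix m k) → HasIndepOnes A t → HasIndepOnes (AppendZero b A) t
indep-appendZero⁺ {k = k} b A = indep-embed {G = A} {AppendZero b A} id (_↑ˡ b) id (↑ˡ-injective b _ _)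
  λ i j one → trans (cong [ A i , const false ]′ (splitAt-↑ˡ k j b)) one

indep-appendZero⁻ : (b : ℕ) (A : BinMatrix m k) → HasIndepOnes (AppendZero b A) t → HasIndepOnes A t
indep-appendZero⁻ {m = m} {k = k} {t = t} b A (r , c′ , r-injective , c′-injective , ones) =
  r , c , r-injective , c-injective , λ i → proj₂ (proj₂ (block i))
  where
  block : (i : Fin t) → ∃ λ c → c ↑ˡ b ≡ c′ i × A (r i) c ≡ true
  block i = one-in-block A b (r i) (c′ i) (ones i)
  c : Fin t → Fin k
  c i = proj₁ (block i)
  c-injective : Injective _≡_ _≡_ c
  c-injective {i} {j} ci≡cj = c′-injective
    (trans (sym (proj₁ (proj₂ (block i)))) (trans (cong (_↑ˡ b) ci≡cj) (proj₁ (proj₂ (block j)))))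

zero-appendZero : (b : ℕ) (A : BinMatrix m k) {s : ℕ} →
                  HasZeroSubmatrixSum A s → HasZeroSubmatrixSum (AppendZero b A) (s + b)
zero-appendZero {k = k} b A {s} (R , C , 1≤∣R∣ , 1≤∣C∣ , sum≡s , zero-block) =
  R , C ++ ⊤ , 1≤∣R∣ , subst (1 ≤_) (sym ∣C++⊤∣) (≤-trans 1≤∣C∣ (m≤m+n ∣ C ∣ b)) , sum≡s+b , zero-block′
  where
  ∣C++⊤∣ : ∣ C ++ ⊤ ∣ ≡ ∣ C ∣ + b
  ∣C++⊤∣ = trans (∣p++q∣≡∣p∣+∣q∣ C ⊤) (cong (∣ C ∣ +_) (∣⊤∣≡n b))

  sum≡s+b : ∣ R ∣ + ∣ C ++ ⊤ ∣ ≡ s + b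
  sum≡s+b = trans (cong (∣ R ∣ +_) ∣C++⊤∣) (trans (sym (+-assoc ∣ R ∣ ∣ C ∣ b)) (cong (_+ b) sum≡s))

  zero-block′ : ∀ i j → i ∈ R → j ∈ C ++ ⊤ → [ A i , const false ]′ (splitAt k j) ≡ false
  zero-block′ i j i∈R j∈ with splitAt k j in split≡
  ... | inj₁ c = zero-block i c i∈R (∈-++⁻ˡ C ⊤ (subst (_∈ C ++ ⊤) (sym (splitAt⁻¹-↑ˡ split≡)) j∈))
  ... | inj₂ _ = refl

theorem39 : (m k b : ℕ) → 1 ≤ b → 1 ≤ k →
    (F : BinMatrix m (k + b)) (A : BinMatrix m k) →
    (σ : Permutation′ m) (τ : Permutation′ (k + b)) →
    (∀ i j → F (σ ⟨$⟩ʳ i) (τ ⟨$⟩ʳ j) ≡ AppendZero b A i j) →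
    ((IsW F (m + b) → IsV F (m ⊓ k) × IsV A (m ⊓ k))
    × (∀ wA wF → IsW A wA → IsW F wF → m ⊔ k < wA → m + b < wF)
    × (∀ wA → IsW F (m + b) → IsW A wA → wA ≤ m ⊔ k))
theorem39 m k b _ _ F A σ τ F≈AO = part-a , part-b , part-c
  where
  AO : BinMatrix m (k + b)
  AO = AppendZero b A

  w-bound : ∀ {wF s} → IsW F wF → HasZeroSubmatrixSum A s → s + b ≤ wF
  w-bound (_ , maximal) zero-s =
    maximal _ (inj₂ (zero-permute F AO σ τ F≈AO (zero-appendZero b A zero-s)))

  zeros-small : IsW F (m + b) → ∀ s → HasZeroSubmatrixSum A s → s ≤ m
  zeros-small wF s zero-s = +-cancelʳ-≤ b s m (w-bound wF zero-s)

  indep-lift : HasIndepOnes A t → HasIndepOnes F t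
  indep-lift = indep-permute F AO σ τ F≈AO ∘ indep-appendZero⁺ b A

  indep-unlift : HasIndepOnes F t → HasIndepOnes A t
  indep-unlift = indep-appendZero⁻ b A ∘ indep-permute AO F (flip σ) (flip τ) (permuted-sym F AO σ τ F≈AO)

  part-a : IsW F (m + b) → IsV F (m ⊓ k) × IsV A (m ⊓ k)
  part-a wF = (indep-lift ones , λ t → indep≤ A t ∘ indep-unlift) , (ones , indep≤ A)
    where
    ones : HasIndepOnes A (m ⊓ k)
    ones = frobenius-konig A (λ s zero-s → ≤-trans (zeros-small wF s zero-s) (m≤m⊔n m k))

  part-b : ∀ wA wF → IsW A wA → IsW F wF → m ⊔ k < wA → m + b < wF
  part-b wA wF (inj₁ refl , _)   _  ()
  part-b wA wF (inj₂ zero-A , _) wF′ m⊔k<wA =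
    <-≤-trans (+-monoˡ-< b (≤-<-trans (m≤m⊔n m k) m⊔k<wA)) (w-bound wF′ zero-A)

  part-c : ∀ wA → IsW F (m + b) → IsW A wA → wA ≤ m ⊔ k
  part-c wA _  (inj₁ refl , _)   = z≤n
  part-c wA wF (inj₂ zero-A , _) = ≤-trans (zeros-small wF wA zero-A) (m≤m⊔n m k)
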